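{- Fix $n\ge1$ and run $\textsc{Generate}()$ (described in the context). Let $D_n$ be the total number of calls to $\textsc{Dispatch}$ and $O_n$ the total number of calls to $\textsc{Output}$ during the execution. Then $D_n\le 2\,O_n$.
   Context: Generating algorithm with parameter $n\ge1$: global counter $c$, arrays $s_0,s_1:\{1..n\}\to\{1..n\}$, stack $S$ (initially empty) with $\textsc{Push}$, $\textsc{Pop}$ (top element), $\textsc{StackIsEmpty}$, and $\textsc{Mask}(t)/\textsc{Reveal}(t)$ (temporarily remove $t$ from $S$ / reinsert it at the same position). $\textsc{Output}()$ is a user-supplied procedure making no further calls. $\textsc{Generate}()$: if $n\ge1$: $c\leftarrow2$; $s_0[1]\leftarrow1$; $\textsc{Dispatch}(1)$. Then if $n\ge3$: $c\leftarrow4$; $s_0[1]\leftarrow2$; $s_0[2]\leftarrow3$; $s_0[3]\leftarrow1$; $\textsc{Push}(1)$; $\textsc{Push}(2)$; $\textsc{Dispatch}(3)$. $\textsc{Dispatch}(s)$: $\textsc{TryClosedWhite}(s)$; if $c+3\le n+1$ then $\textsc{TryForward}(s)$; if $c+1\le n+1$ then $\textsc{TryClosedBlack}(s)$; for each $t$ currently in $S$: $\textsc{Mask}(t)$; $\textsc{TryBackward}(s,t)$; $\textsc{Reveal}(t)$. $\textsc{TryClosedWhite}(s)$: $s_1[s]\leftarrow s$; $\textsc{Recurse}()$. $\textsc{TryForward}(s)$: $s_0[c]\leftarrow c+1$; $s_0[c+1]\leftarrow c+2$; $s_0[c+2]\leftarrow c$; $s_1[s]\leftarrow c$; $s_1[c]\leftarrow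 s$; $\textsc{Push}(c+1)$; $\textsc{Push}(c+2)$; $c\leftarrow c+3$; $\textsc{Recurse}()$; $c\leftarrow c-3$; $\textsc{Pop}()$; $\textsc{Pop}()$. $\textsc{TryClosedBlack}(s)$: $s_1[s]\leftarrow c$; $s_1[c]\leftarrow s$; $s_0[c]\leftarrow c$; $c\leftarrow c+1$; $\textsc{Recurse}()$; $c\leftarrow c-1$. $\textsc{TryBackward}(s,t)$: $s_1[s]\leftarrow t$; $s_1[t]\leftarrow s$; $\textsc{Recurse}()$. $\textsc{Recurse}()$: if $S$ empty then $\textsc{Output}()$; else $k\leftarrow\textsc{Pop}()$; $\textsc{Dispatch}(k)$; $\textsc{Push}(k)$. -}

module Defs where

open import Data.Nat using (ℕ; zero; suc; _+_; _*_; _≤_)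
open import Data.List using (List; []; _∷_; _++_; _∷ʳ_)
open import Relation.Nullary using (¬_)

-- Big-step semantics of the generating algorithm, tracking only the
-- control-relevant state: the parameter n, the global counter c and the
-- stack S (a list, head = top).  The arrays s₀, s₁ are write-only and
-- never influence control flow, so they are omitted.
--
-- Disp n c S d o : calling Dispatch(s) (s already popped) with counter c and
--   stack S terminates, making d calls to Dispatch (this one included) and
--   o calls to Output in total.
-- Rec  n c S d o : the same for a call Recurse() in state (c , S).
-- RecWhen n c S d o : "if c ≤ n+1 then Recurse() in state (c , S)"
--   (used for TryForward, whose guard c+3 ≤ n+1 is about the new counter,
--    and for TryClosedBlack, whose guard c+1 ≤ n+1 is about the new counter).
-- Loop n c pre rest d o : the loop "for each t in S: Mask t; TryBackward; Reveal t"
--   where S = pre ++ rest and the elements of pre have already been handled.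

mutual
  data Rec (n : ℕ) (c : ℕ) : List ℕ → ℕ → ℕ → Set where
    rec-empty : Rec n c [] 0 1
    rec-pop   : ∀ {k S d o} → Disp n c S d o → Rec n c (k ∷ S) d o

  data RecWhen (n : ℕ) (c : ℕ) (S : List ℕ) : ℕ → ℕ → Set where
    when-run  : ∀ {d o} → c ≤ suc n → Rec n c S d o → RecWhen n c S d o
    when-skip : ¬ (c ≤ suc n) → RecWhen n c S 0 0

  data Loop (n : ℕ) (c : ℕ) : List ℕ → List ℕ → ℕ → ℕ → Set where
    loop-done : ∀ {pre} → Loop n c pre [] 0 0
    loop-step : ∀ {pre t rest d₁ o₁ d₂ o₂} →
                Rec n c (pre ++ rest) d₁ o₁ →          -- TryBackward with t masked
                Loop n c (pre ∷ʳ t) rest d₂ o₂ →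
                Loop n c pre (t ∷ rest) (d₁ + d₂) (o₁ + o₂)

  data Disp (n : ℕ) (c : ℕ) (S : List ℕ) : ℕ → ℕ → Set where
    disp : ∀ {d₁ o₁ d₂ o₂ d₃ o₃ d₄ o₄} →
           Rec n c S d₁ o₁ →                                            -- TryClosedWhite
           RecWhen n (c + 3) ((c + 2) ∷ (c + 1) ∷ S) d₂ o₂ →           -- TryForward
           RecWhen n (c + 1) S d₃ o₃ →                                  -- TryClosedBlack
           Loop n c [] S d₄ o₄ →
           Disp n c S (1 + d₁ + d₂ + d₃ + d₄) (o₁ + o₂ + o₃ + o₄)

-- Second phase of Generate (only when n ≥ 3): c ← 4, Push 1, Push 2, Dispatch(3).
data GenSecond (n : ℕ) : ℕ → ℕ → Set where
  second-run  : ∀ {d o} → 3 ≤ n → Disp n 4 (2 ∷ 1 ∷ []) d o → GenSecond n d o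
  second-skip : ¬ (3 ≤ n) → GenSecond n 0 0

-- Gen n D O : Generate() (for n ≥ 1) terminates with D calls to Dispatch and
-- O calls to Output.  First phase: c ← 2, empty stack, Dispatch(1).
data Gen (n : ℕ) : ℕ → ℕ → Set where
  gen : ∀ {d₁ o₁ d₂ o₂} → Disp n 2 [] d₁ o₁ → GenSecond n d₂ o₂ →
        Gen n (d₁ + d₂) (o₁ + o₂)

-- Counting by calls: a Recurse either outputs (0 dispatches, 1 output) or
-- pops into a single Dispatch, so it suffices that every Dispatch makes
-- strictly fewer Dispatch calls than twice its outputs.  On an empty stack
-- its TryClosedWhite Recurse outputs at once, which pays for the Dispatch
-- itself; on a nonempty stack it makes at least two Recurse calls
-- (TryClosedWhite and the first TryBackward), each with d + 1 ≤ 2 o, which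
-- together leave room for the Dispatch itself.  Termination: 3 (n + 1 − c) + |S|
-- drops with every pop and never grows from a Dispatch to its Recurse calls.
module Submission where

open import Defs
open import Data.Nat using (ℕ; _*_; _≤_)
open import Data.Product using (Σ; _×_; ∃₂)

open import Data.Nat using (zero; suc; _+_; _∸_; _<_; _≤?_; z≤n; s≤s)
open import Data.Nat.Properties
open import Data.Nat.Tactic.RingSolver using (solve-∀)
open import Data.List using (List; []; _∷_; _++_; _∷ʳ_; [_]; length)
open import Data.List.Properties using (length-++-sucʳ; ++-assoc)
open import Data.Product using (_,_)
open import Relation.Nullary using (yes; no)
open import Relation.Binary.PropositionalEquality using (_≡_; sym; cong; subst; module ≡-Reasoning)

+-mono-double : ∀ {a b} x y → a ≤ 2 * x → b ≤ 2 * y → a + b ≤ 2 * (x + y)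
+-mono-double {a} {b} x y p q = subst (a + b ≤_) (sym (*-distribˡ-+ 2 x y)) (+-mono-≤ p q)

mutual
  Rec⇒< : ∀ {n c S d o} → Rec n c S d o → d < 2 * o
  Rec⇒< rec-empty   = s≤s z≤n
  Rec⇒< (rec-pop D) = Disp⇒< D

  RecWhen⇒≤ : ∀ {n c S d o} → RecWhen n c S d o → d ≤ 2 * o
  RecWhen⇒≤ (when-run _ r) = <⇒≤ (Rec⇒< r)
  RecWhen⇒≤ (when-skip _)  = z≤n

  Loop⇒≤ : ∀ {n c pre rest d o} → Loop n c pre rest d o → d ≤ 2 * o
  Loop⇒≤ loop-done = z≤n
  Loop⇒≤ (loop-step {o₁ = o₁} {o₂ = o₂} r l) =
    +-mono-double o₁ o₂ (<⇒≤ (Rec⇒< r)) (Loop⇒≤ l)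

  nonempty-Loop⇒< : ∀ {n c pre t rest d o} → Loop n c pre (t ∷ rest) d o → d < 2 * o
  nonempty-Loop⇒< (loop-step {o₁ = o₁} {o₂ = o₂} r l) =
    +-mono-double o₁ o₂ (Rec⇒< r) (Loop⇒≤ l)

  Disp⇒< : ∀ {n c S d o} → Disp n c S d o → d < 2 * o
  Disp⇒< (disp {o₂ = o₂} {o₃ = o₃} rec-empty w₁ w₂ loop-done) =
    +-mono-double (1 + o₂ + o₃) 0
      (+-mono-double (1 + o₂) o₃ (+-mono-double 1 o₂ ≤-refl (RecWhen⇒≤ w₁)) (RecWhen⇒≤ w₂))
      z≤n
  Disp⇒< (disp {d₁} {o₁} {d₂} {o₂} {d₃} {o₃} {d₄} {o₄} r@(rec-pop _) w₁ w₂ l@(loop-step _ _)) =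
    subst (_≤ 2 * (o₁ + o₂ + o₃ + o₄)) (+-suc (suc d₁ + d₂ + d₃) d₄)
      (+-mono-double (o₁ + o₂ + o₃) o₄
        (+-mono-double (o₁ + o₂) o₃ (+-mono-double o₁ o₂ (Rec⇒< r) (RecWhen⇒≤ w₁)) (RecWhen⇒≤ w₂))
        (nonempty-Loop⇒< l))

GenSecond⇒≤ : ∀ {n d o} → GenSecond n d o → d ≤ 2 * o
GenSecond⇒≤ (second-run _ D) = <⇒≤ (Disp⇒< D)
GenSecond⇒≤ (second-skip _)  = z≤n

Gen⇒≤ : ∀ {n D O} → Gen n D O → D ≤ 2 * O
Gen⇒≤ (gen {o₁ = o₁} {o₂ = o₂} D G) = +-mono-double o₁ o₂ (<⇒≤ (Disp⇒< D)) (GenSecond⇒≤ G)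

m∸n≡o+[m∸[n+o]] : ∀ {m} n o → n + o ≤ m → m ∸ n ≡ o + (m ∸ (n + o))
m∸n≡o+[m∸[n+o]] {m} n o n+o≤m = begin
  m ∸ n                       ≡⟨ cong (_∸ n) (sym (m+[n∸m]≡n n+o≤m)) ⟩
  n + o + (m ∸ (n + o)) ∸ n   ≡⟨ cong (_∸ n) (+-assoc n o _) ⟩
  n + (o + (m ∸ (n + o))) ∸ n ≡⟨ m+n∸m≡n n _ ⟩
  o + (m ∸ (n + o))           ∎
  where open ≡-Reasoning

module Termination (n : ℕ) where

  weight : ℕ → List ℕ → ℕ
  weight c S = 3 * (suc n ∸ c) + length S

  weight-pop : ∀ c k S → weight c (k ∷ S) ≡ suc (weight c S)
  weight-pop c k S = +-suc _ (length S)

  weight-forward : ∀ c a b S → c + 3 ≤ suc n → weight (c + 3) (a ∷ b ∷ S) ≤ weight c S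
  weight-forward c _ _ S c+3≤1+n = begin
    3 * r + (2 + L)     ≤⟨ m≤m+n _ 7 ⟩
    3 * r + (2 + L) + 7 ≡⟨ regroup r L ⟩
    3 * (3 + r) + L     ≡⟨ cong (λ x → 3 * x + L) (sym (m∸n≡o+[m∸[n+o]] c 3 c+3≤1+n)) ⟩
    weight c S          ∎
    where
    open ≤-Reasoning
    r = suc n ∸ (c + 3)
    L = length S
    regroup : ∀ r L → 3 * r + (2 + L) + 7 ≡ 3 * (3 + r) + L
    regroup = solve-∀

  weight-black : ∀ c S → weight (c + 1) S ≤ weight c S
  weight-black c S =
    +-monoˡ-≤ (length S) (*-monoʳ-≤ 3 (∸-monoʳ-≤ (suc n) (m≤m+n c 1)))

  weight-mask : ∀ c pre t rest → weight c (pre ++ rest) ≤ weight c (pre ++ t ∷ rest)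
  weight-mask c pre t rest =
    +-monoʳ-≤ (3 * (suc n ∸ c))
      (subst (length (pre ++ rest) ≤_) (sym (length-++-sucʳ pre t rest)) (n≤1+n _))

  mutual
    Rec-fuelled : ∀ f c S → weight c S < f → ∃₂ (Rec n c S)
    Rec-fuelled zero    _ _       ()
    Rec-fuelled (suc f) c []      _ = 0 , 1 , rec-empty
    Rec-fuelled (suc f) c (k ∷ S) w<f =
      let d , o , D = Disp-fuelled f c S (≤-pred (subst (_< suc f) (weight-pop c k S) w<f))
      in  d , o , rec-pop D

    RecWhen-fuelled : ∀ f c S → (c ≤ suc n → weight c S < f) → ∃₂ (RecWhen n c S)
    RecWhen-fuelled f c S w<f with c ≤? suc n
    ... | yes c≤1+n = let d , o , r = Rec-fuelled f c S (w<f c≤1+n) in d , o , when-run c≤1+n r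
    ... | no  c≰1+n = 0 , 0 , when-skip c≰1+n

    Loop-fuelled : ∀ f c pre rest → weight c (pre ++ rest) < f → ∃₂ (Loop n c pre rest)
    Loop-fuelled f c pre []         _   = 0 , 0 , loop-done
    Loop-fuelled f c pre (t ∷ rest) w<f =
      let _ , _ , r = Rec-fuelled f c (pre ++ rest) (≤-<-trans (weight-mask c pre t rest) w<f)
          _ , _ , l = Loop-fuelled f c (pre ∷ʳ t) rest
                        (subst (λ S → weight c S < f) (sym (++-assoc pre [ t ] rest)) w<f)
      in  _ , _ , loop-step r l

    Disp-fuelled : ∀ f c S → weight c S < f → ∃₂ (Disp n c S)
    Disp-fuelled f c S w<f =
      let _ , _ , r  = Rec-fuelled f c S w<f
          _ , _ , w₁ = RecWhen-fuelled f (c + 3) (c + 2 ∷ c + 1 ∷ S)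
                         (λ c+3≤1+n → ≤-<-trans (weight-forward c (c + 2) (c + 1) S c+3≤1+n) w<f)
          _ , _ , w₂ = RecWhen-fuelled f (c + 1) S (λ _ → ≤-<-trans (weight-black c S) w<f)
          _ , _ , l  = Loop-fuelled f c [] S w<f
      in  _ , _ , disp r w₁ w₂ l

  Dispatch-terminates : ∀ c S → ∃₂ (Disp n c S)
  Dispatch-terminates c S = Disp-fuelled (suc (weight c S)) c S ≤-refl

open Termination using (Dispatch-terminates)

GenSecond-terminates : ∀ n → ∃₂ (GenSecond n)
GenSecond-terminates n with 3 ≤? n
... | yes 3≤n = let _ , _ , D = Dispatch-terminates n 4 (2 ∷ 1 ∷ []) in _ , _ , second-run 3≤n D
... | no  3≰n = 0 , 0 , second-skip 3≰n

Generate-terminates : ∀ n → ∃₂ (Gen n)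
Generate-terminates n =
  let _ , _ , D = Dispatch-terminates n 2 []
      _ , _ , G = GenSecond-terminates n
  in  _ , _ , gen D G

-- The algorithm terminates for every n.
lemma3p5 : (n : ℕ) → 1 ≤ n →
    ∃₂ (λ D O → Gen n D O) × (∀ D O → Gen n D O → D ≤ 2 * O)
lemma3p5 n _ = Generate-terminates n , λ _ _ → Gen⇒≤
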